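{- Let $t=t[1]t[2]t[3]\cdots$ be the Thue–Morse word over $\{a,b\}$, i.e. the fixed point starting with $a$ of the morphism $\tau: a\mapsto abba,\ b\mapsto baab$ (so $t=abbabaabbaababba\cdots$). For $n\ge 0$ let $PPL_t(n)$ denote the minimal number of (nonempty) palindromes whose concatenation equals the prefix $t[1]\cdots t[n]$ of length $n$, with $PPL_t(0)=0$. Then for all $n\ge 0$: \begin{align*} PPL_t(4n)&=PPL_t(n),\\ PPL_t(4n+1)&=PPL_t(n)+1,\\ PPL_t(4n+2)&=\min(PPL_t(n),PPL_t(n+1))+2,\\ PPL_t(4n+3)&=PPL_t(n+1)+1. \end{align*}
   Context: A palindrome is a finite word $p=p[1]\cdots p[n]$ with $p[i]=p[n-i+1]$ for all $i$. The prefix palindromic length $PPL_t(n)$ is the minimal number of palindromes in a factorization of the length-$n$ prefix of $t$. -}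

module Defs where

open import Data.Nat using (ℕ; zero; suc; _+_; _*_; _≤_)
open import Data.List using (List; []; _∷_; _++_; concat; length; reverse; concatMap; take; lookup)
open import Data.List.Relation.Unary.All using (All)
open import Data.Product using (_×_; Σ; ∃-syntax)
open import Relation.Binary.PropositionalEquality using (_≡_; _≢_)

data Letter : Set where
  a b : Letter

τ : Letter → List Letter
τ a = a ∷ b ∷ b ∷ a ∷ []
τ b = b ∷ a ∷ a ∷ b ∷ []

τ^_a : ℕ → List Letter
τ^ zero a = a ∷ []
τ^ suc k a = concatMap τ (τ^ k a)

-- The Thue–Morse word t as the limit of τ^k(a) (the fixed point of τ starting with a).
-- t i (0-indexed, i.e. t i = t[i+1] in the paper) is the i-th letter of τ^(i+1)(a),
-- which is a prefix of t of length 4^(i+1) > i. Out-of-range fallback never happens.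
nth : List Letter → ℕ → Letter
nth []       _       = a
nth (x ∷ _)  zero    = x
nth (_ ∷ xs) (suc i) = nth xs i

t : ℕ → Letter
t i = nth (τ^ (suc i) a) i

prefix : ℕ → List Letter
prefix zero    = []
prefix (suc n) = prefix n ++ (t n ∷ [])

IsPalindrome : List Letter → Set
IsPalindrome p = reverse p ≡ p

NonEmpty : List Letter → Set
NonEmpty p = p ≢ []

PalFact : List Letter → ℕ → Set
PalFact w k = ∃[ ps ] (All (λ p → NonEmpty p × IsPalindrome p) ps × concat ps ≡ w × length ps ≡ k)

IsPalLength : List Letter → ℕ → Set
IsPalLength w k = PalFact w k × (∀ m → PalFact w m → k ≤ m)

IsPPL : ℕ → ℕ → Set
IsPPL n k = IsPalLength (prefix n) k

module Submission where

-- The palindromic length of prefixes of the Thue–Morse word t satisfies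
--   PPL(4n) = PPL(n),  PPL(4n+1) = PPL(n)+1,  PPL(4n+2) = min(PPL(n), PPL(n+1))+2,
--   PPL(4n+3) = PPL(n+1)+1.
-- Positions are 0-indexed; t[S..S+L) is the factor of length L at S.  As t = τ(t),
-- block i of t is t[4i..4i+4) = τ(t i) = x x̄ x̄ x with x = t i.
-- 1. Letters: t(4i) = t(4i+3) = t i and t(4i+1) = t(4i+2) = flip (t i).
-- 2. Palindromic factors (inductive 'Pal'): τ maps a palindrome t[s..s+L) to the palindrome
--    t[4s..4s+4L), and conversely; moreover every nonempty palindromic factor of t has one of
--    a few 'Shape's: a letter, length 3 starting at 4s+2 or 4s+3, or of even length and
--    centred on a block boundary or block middle, so that it descends to a palindrome of t.
-- 3. Factorizations of the prefix of length N are encoded as cut sequences 'Cuts N k'.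
-- 4. Upper bounds: apply τ to a factorization of the prefix of length n or n+1 and adjust
--    the last block with single letters.
-- 5. Lower bound: by induction on a factorization of the prefix of length 4n+r, the
--    invariant 'Goal n r k' (a factorization of the prefix of length n or n+1 that is
--    shorter by the amount the theorem predicts) survives appending each Shape.
-- The theorem combines the upper and lower bounds for each residue r.

open import Defs
open import Data.Nat using (ℕ; zero; suc; _+_; _*_; _≤_; _<_; _≤′_; ≤′-refl; ≤′-step; z≤n; s≤s; _⊓_)
open import Data.Nat.Properties
open import Data.Nat.DivMod using (_%_; m<n⇒m%n≡m; [m+kn]%n≡m%n)
open import Data.Nat.Tactic.RingSolver using (solve-∀)
open import Data.List using (List; []; _∷_; _++_; _∷ʳ_; concat; concatMap; length; reverse)
open import Data.List.Properties
  using (++-identityʳ; ++-assoc; concatMap-++; concat-++; length-++; ∷-injective; ∷ʳ-injective; unfold-reverse; reverse-++)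
open import Data.List.Relation.Unary.All using (All; []; _∷_)
open import Data.List.Relation.Unary.All.Properties using (++⁺)
open import Data.Product using (_×_; _,_; ∃)
open import Data.Sum using (_⊎_; inj₁; inj₂)
open import Data.Empty using (⊥; ⊥-elim)
open import Relation.Binary.PropositionalEquality

flip : Letter → Letter
flip a = b
flip b = a

flip-injective : ∀ {x y} → flip x ≡ flip y → x ≡ y
flip-injective {a} {a} _ = refl
flip-injective {b} {b} _ = refl
flip-injective {a} {b} ()
flip-injective {b} {a} ()

flip-no-fixpoint : ∀ {x} → x ≢ flip x
flip-no-fixpoint {a} ()
flip-no-fixpoint {b} ()

τ-shape : ∀ x → τ x ≡ x ∷ flip x ∷ flip x ∷ x ∷ []
τ-shape a = refl
τ-shape b = refl

tm : ℕ → List Letter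
tm k = τ^ k a

length-τ* : ∀ xs → length (concatMap τ xs) ≡ length xs * 4
length-τ* []       = refl
length-τ* (a ∷ xs) = cong (4 +_) (length-τ* xs)
length-τ* (b ∷ xs) = cong (4 +_) (length-τ* xs)

length-tm : ∀ k → k < length (tm k)
length-tm zero    = s≤s z≤n
length-tm (suc k) rewrite length-τ* (tm k) = grow (length-tm k)
  where
  grow : ∀ {L} → k < L → suc k < L * 4
  grow {suc L} (s≤s k≤L) = s≤s (s≤s (≤-trans k≤L (≤-trans (m≤m*n L 4) (m≤n+m _ 2))))

tm-step : ∀ k → ∃ λ r → tm (suc k) ≡ tm k ++ r
tm-step zero    = b ∷ b ∷ a ∷ [] , refl
tm-step (suc k) with r , eq ← tm-step k =
  concatMap τ r , trans (cong (concatMap τ) eq) (concatMap-++ τ (tm k) r)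

tm-prefix : ∀ {k m} → k ≤′ m → ∃ λ r → tm m ≡ tm k ++ r
tm-prefix ≤′-refl = [] , sym (++-identityʳ _)
tm-prefix {k} (≤′-step {m} k≤m) with r , eq ← tm-prefix k≤m | r′ , eq′ ← tm-step m =
  r ++ r′ , (begin
    tm (suc m)         ≡⟨ eq′ ⟩
    tm m ++ r′         ≡⟨ cong (_++ r′) eq ⟩
    (tm k ++ r) ++ r′  ≡⟨ ++-assoc (tm k) r r′ ⟩
    tm k ++ (r ++ r′)  ∎)
  where open ≡-Reasoning

nth-++ : ∀ xs ys i → i < length xs → nth (xs ++ ys) i ≡ nth xs i
nth-++ (x ∷ xs) ys zero    _         = refl
nth-++ (x ∷ xs) ys (suc i) (s≤s i<n) = nth-++ xs ys i i<n

nth-tm : ∀ k i → i < length (tm k) → nth (tm k) i ≡ t i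
nth-tm k i i<k with ≤-total k (suc i)
... | inj₁ k≤ with r , eq ← tm-prefix (≤⇒≤′ k≤) =
  sym (trans (cong (λ w → nth w i) eq) (nth-++ (tm k) r i i<k))
... | inj₂ ≤k with r , eq ← tm-prefix (≤⇒≤′ ≤k) =
  trans (cong (λ w → nth w i) eq) (nth-++ (tm (suc i)) r i (<-trans (n<1+n i) (length-tm (suc i))))

nth-τ* : ∀ xs i j → j < 4 → i < length xs → nth (concatMap τ xs) (i * 4 + j) ≡ nth (τ (nth xs i)) j
nth-τ* (a ∷ xs) zero    j j<4 _         = nth-++ (τ a) _ j j<4
nth-τ* (b ∷ xs) zero    j j<4 _         = nth-++ (τ b) _ j j<4
nth-τ* (a ∷ xs) (suc i) j j<4 (s≤s i<n) = nth-τ* xs i j j<4 i<n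
nth-τ* (b ∷ xs) (suc i) j j<4 (s≤s i<n) = nth-τ* xs i j j<4 i<n

-- t is the fixed point of τ: block i of t is τ(t i).  (The second step is definitional,
-- since t m is read off τ(τᵐ(a)).)
t-block : ∀ i j → j < 4 → t (j + i * 4) ≡ nth (τ (t i)) j
t-block i j j<4 = begin
  t (j + i * 4)                                  ≡⟨ cong t (+-comm j (i * 4)) ⟩
  nth (concatMap τ (tm (i * 4 + j))) (i * 4 + j) ≡⟨ nth-τ* (tm (i * 4 + j)) i j j<4 i<len ⟩
  nth (τ (nth (tm (i * 4 + j)) i)) j             ≡⟨ cong (λ x → nth (τ x) j) (nth-tm (i * 4 + j) i i<len) ⟩
  nth (τ (t i)) j                                ∎
  where
  open ≡-Reasoning
  i<len : i < length (tm (i * 4 + j))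
  i<len = ≤-<-trans (≤-trans (m≤m*n i 4) (m≤m+n (i * 4) j)) (length-tm (i * 4 + j))

t-4i : ∀ i → t (i * 4) ≡ t i
t-4i i = trans (t-block i 0 (s≤s z≤n)) (cong (λ w → nth w 0) (τ-shape (t i)))

t-4i+1 : ∀ i → t (1 + i * 4) ≡ flip (t i)
t-4i+1 i = trans (t-block i 1 (s≤s (s≤s z≤n))) (cong (λ w → nth w 1) (τ-shape (t i)))

t-4i+2 : ∀ i → t (2 + i * 4) ≡ flip (t i)
t-4i+2 i = trans (t-block i 2 (s≤s (s≤s (s≤s z≤n)))) (cong (λ w → nth w 2) (τ-shape (t i)))

t-4i+3 : ∀ i → t (3 + i * 4) ≡ t i
t-4i+3 i = trans (t-block i 3 (s≤s (s≤s (s≤s (s≤s z≤n))))) (cong (λ w → nth w 3) (τ-shape (t i)))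

-- Pal S L : the factor t[S..S+L) is a palindrome, built by matching its outer letters.
data Pal : ℕ → ℕ → Set where
  empty  : ∀ {S} → Pal S 0
  single : ∀ {S} → Pal S 1
  wrap   : ∀ {S L} → t S ≡ t (suc L + S) → Pal (suc S) L → Pal S (suc (suc L))

peel : ∀ {S L} → Pal S (suc (suc L)) → Pal (suc S) L
peel (wrap _ p) = p

pal-ends : ∀ {S L} → Pal S (suc L) → t S ≡ t (L + S)
pal-ends single     = refl
pal-ends (wrap e _) = e

regroup : ∀ N k s → N * 4 + (k + s * 4) ≡ k + (N + s) * 4
regroup = solve-∀

shift-end : ∀ x d {z z′} → z ≡ z′ → t x ≡ t (d + z) → t x ≡ t (d + z′)
shift-end x d z≡z′ e = trans e (cong (λ z → t (d + z)) z≡z′)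

-- Since each block is x x̄ x̄ x, equal letters t x = t y make positions j and 3-j of the
-- blocks x and y equal ...
module _ (x y : ℕ) (e : t x ≡ t y) where
  mirror₀ : t (x * 4) ≡ t (3 + y * 4)
  mirror₀ = trans (t-4i x) (trans e (sym (t-4i+3 y)))

  mirror₁ : t (1 + x * 4) ≡ t (2 + y * 4)
  mirror₁ = trans (t-4i+1 x) (trans (cong flip e) (sym (t-4i+2 y)))

  mirror₂ : t (2 + x * 4) ≡ t (1 + y * 4)
  mirror₂ = trans (t-4i+2 x) (trans (cong flip e) (sym (t-4i+1 y)))

  mirror₃ : t (3 + x * 4) ≡ t (y * 4)
  mirror₃ = trans (t-4i+3 x) (trans e (sym (t-4i y)))

module _ (x y : ℕ) where
  unmirror₀ : t (x * 4) ≡ t (3 + y * 4) → t x ≡ t y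
  unmirror₀ e = trans (sym (t-4i x)) (trans e (t-4i+3 y))

  unmirror₁ : t (1 + x * 4) ≡ t (2 + y * 4) → t x ≡ t y
  unmirror₁ e = flip-injective (trans (sym (t-4i+1 x)) (trans e (t-4i+2 y)))

  unmirror₂ : t (2 + x * 4) ≡ t (1 + y * 4) → t x ≡ t y
  unmirror₂ e = flip-injective (trans (sym (t-4i+2 x)) (trans e (t-4i+1 y)))

-- Extending a palindrome by the mirrored letters k and 3-k of blocks s and N + s (or
-- suc N + s); four layers reconstruct τ of a palindrome around its inner part.
module _ (s N : ℕ) where
  layer₀ : t s ≡ t (N + s) → Pal (1 + s * 4) (2 + N * 4) → Pal (s * 4) (suc N * 4)
  layer₀ e = wrap (shift-end (s * 4) 3 (sym (regroup N 0 s)) (mirror₀ s (N + s) e))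

  layer₁ : t s ≡ t (N + s) → Pal (2 + s * 4) (N * 4) → Pal (1 + s * 4) (2 + N * 4)
  layer₁ e = wrap (shift-end (1 + s * 4) 1 (sym (regroup N 1 s)) (mirror₁ s (N + s) e))

  layer₂ : t s ≡ t (suc N + s) → Pal (3 + s * 4) (2 + N * 4) → Pal (2 + s * 4) (suc N * 4)
  layer₂ e = wrap (shift-end (2 + s * 4) 3 (sym (regroup N 2 s)) (mirror₂ s (suc N + s) e))

  layer₃ : t s ≡ t (suc N + s) → Pal (suc s * 4) (N * 4) → Pal (3 + s * 4) (2 + N * 4)
  layer₃ e = wrap (shift-end (3 + s * 4) 1 (sym (regroup N 3 s)) (mirror₃ s (suc N + s) e))

pal-×4 : ∀ {s L} → Pal s L → Pal (s * 4) (L * 4)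
pal-×4 empty = empty
pal-×4 {s} single = layer₀ s 0 refl (layer₁ s 0 refl empty)
pal-×4 {s} (wrap {L = M} e p) =
  layer₀ s (suc M) e (layer₁ s (suc M) e (layer₂ s M e (layer₃ s M e (pal-×4 p))))

pal-÷4 : ∀ s L → Pal (s * 4) (L * 4) → Pal s L
pal-÷4 s zero          _ = empty
pal-÷4 s (suc zero)    _ = single
pal-÷4 s (suc (suc M)) (wrap e (wrap _ (wrap _ (wrap _ p)))) =
  wrap (unmirror₀ s (suc M + s) (shift-end (s * 4) 3 (regroup (suc M) 0 s) e)) (pal-÷4 (suc s) M p)

-- Even palindromes not made of whole blocks still descend: complete them to whole blocks
-- (the outer letters determine the missing mirrored letters) or strip a partial block.
pal-÷4-from₁ : ∀ s N → Pal (1 + s * 4) (2 + N * 4) → Pal s (suc N)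
pal-÷4-from₁ s N p = pal-÷4 s (suc N) (layer₀ s N ends p)
  where
  ends : t s ≡ t (N + s)
  ends = unmirror₁ s (N + s) (shift-end (1 + s * 4) 1 (regroup N 1 s) (pal-ends p))

pal-÷4-from₂ : ∀ s N → Pal (2 + s * 4) (suc N * 4) → Pal s (2 + N)
pal-÷4-from₂ s N p = pal-÷4 s (2 + N) (layer₀ s (suc N) ends (layer₁ s (suc N) ends p))
  where
  ends : t s ≡ t (suc N + s)
  ends = unmirror₂ s (suc N + s) (shift-end (2 + s * 4) 3 (regroup N 2 s) (pal-ends p))

pal-÷4-from₃ : ∀ s N → Pal (3 + s * 4) (2 + N * 4) → Pal (suc s) N
pal-÷4-from₃ s N p = pal-÷4 (suc s) N (peel p)

data Residue4 : ℕ → Set where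
  at₀ : ∀ s → Residue4 (s * 4)
  at₁ : ∀ s → Residue4 (1 + s * 4)
  at₂ : ∀ s → Residue4 (2 + s * 4)
  at₃ : ∀ s → Residue4 (3 + s * 4)

residue4 : ∀ S → Residue4 S
residue4 zero = at₀ 0
residue4 (suc S) with residue4 S
... | at₀ s = at₁ s
... | at₁ s = at₂ s
... | at₂ s = at₃ s
... | at₃ s = at₀ (suc s)

-- The possible positions S and lengths L of a nonempty palindromic factor of t.
data Shape (S L : ℕ) : Set where
  letter : L ≡ 1 → Shape S L
  odd₂   : ∀ s → S ≡ 2 + s * 4 → L ≡ 3 → Shape S L
  odd₃   : ∀ s → S ≡ 3 + s * 4 → L ≡ 3 → Shape S L
  even₀  : ∀ s N → S ≡ s * 4     → L ≡ suc N * 4 → Shape S L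
  even₁  : ∀ s N → S ≡ 1 + s * 4 → L ≡ 2 + N * 4 → Shape S L
  even₂  : ∀ s N → S ≡ 2 + s * 4 → L ≡ suc N * 4 → Shape S L
  even₃  : ∀ s N → S ≡ 3 + s * 4 → L ≡ 2 + N * 4 → Shape S L

shape₂ : ∀ S → t S ≡ t (1 + S) → Shape S 2
shape₂ S e with residue4 S
... | at₀ s = ⊥-elim (flip-no-fixpoint (trans (sym (t-4i s)) (trans e (t-4i+1 s))))
... | at₁ s = even₁ s 0 refl refl
... | at₂ s = ⊥-elim (flip-no-fixpoint (trans (sym (t-4i+3 s)) (trans (sym e) (t-4i+2 s))))
... | at₃ s = even₃ s 0 refl refl

shape₃ : ∀ S → t S ≡ t (2 + S) → Shape S 3
shape₃ S e with residue4 S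
... | at₀ s = ⊥-elim (flip-no-fixpoint (trans (sym (t-4i s)) (trans e (t-4i+2 s))))
... | at₁ s = ⊥-elim (flip-no-fixpoint (trans (sym (t-4i+3 s)) (trans (sym e) (t-4i+1 s))))
... | at₂ s = odd₂ s refl refl
... | at₃ s = odd₃ s refl refl

no-pal5-at₁ : ∀ s → t (1 + s * 4) ≡ t (5 + s * 4) → t (2 + s * 4) ≡ t (4 + s * 4) → ⊥
no-pal5-at₁ s e e′ = flip-no-fixpoint (begin
  t (suc s)         ≡⟨ sym (t-4i (suc s)) ⟩
  t (4 + s * 4)     ≡⟨ sym e′ ⟩
  t (2 + s * 4)     ≡⟨ t-4i+2 s ⟩
  flip (t s)        ≡⟨ cong flip (flip-injective (trans (sym (t-4i+1 s)) (trans e (t-4i+1 (suc s))))) ⟩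
  flip (t (suc s))  ∎)
  where open ≡-Reasoning

no-pal5-at₂ : ∀ s → t (2 + s * 4) ≡ t (6 + s * 4) → t (3 + s * 4) ≡ t (5 + s * 4) → ⊥
no-pal5-at₂ s e e′ = flip-no-fixpoint (begin
  t s               ≡⟨ sym (t-4i+3 s) ⟩
  t (3 + s * 4)     ≡⟨ e′ ⟩
  t (5 + s * 4)     ≡⟨ t-4i+1 (suc s) ⟩
  flip (t (suc s))  ≡⟨ cong flip (sym (flip-injective (trans (sym (t-4i+2 s)) (trans e (t-4i+2 (suc s)))))) ⟩
  flip (t s)        ∎)
  where open ≡-Reasoning

-- Classification of palindromic factors; longer ones inherit the shape of their inner
-- part, whose residues cycle as the factor grows by one letter on each side.
shape : ∀ {S L} → Pal S (suc L) → Shape S (suc L)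
shape single              = letter refl
shape {S} (wrap e empty)  = shape₂ S e
shape {S} (wrap e single) = shape₃ S e
shape (wrap e p@(wrap e′ _)) with shape p
... | letter ()
... | odd₂ s refl refl          = ⊥-elim (no-pal5-at₁ s e e′)
... | odd₃ s refl refl          = ⊥-elim (no-pal5-at₂ s e e′)
... | even₀ zero    N () _
... | even₀ (suc s) N refl refl = even₃ s (suc N) refl refl
... | even₁ s N refl refl       = even₀ s N refl refl
... | even₂ s N refl refl       = even₁ s (suc N) refl refl
... | even₃ s N refl refl       = even₂ s N refl refl

seg : ℕ → ℕ → List Letter
seg S zero    = []
seg S (suc L) = t S ∷ seg (suc S) L

seg-++ : ∀ S A B → seg S A ++ seg (A + S) B ≡ seg S (A + B)
seg-++ S zero    B = refl
seg-++ S (suc A) B =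
  cong (t S ∷_) (trans (cong (λ z → seg (suc S) A ++ seg z B) (sym (+-suc A S))) (seg-++ (suc S) A B))

seg-split : ∀ p rest S L → p ++ rest ≡ seg S L →
  ∃ λ A → ∃ λ B → A + B ≡ L × p ≡ seg S A × rest ≡ seg (A + S) B
seg-split []      rest S L       e = 0 , L , refl , refl , e
seg-split (x ∷ p) rest S (suc L) e with refl , e′ ← ∷-injective e
  with A , B , refl , refl , refl ← seg-split p rest (suc S) L e′ =
  suc A , B , refl , refl , cong (λ z → seg z B) (+-suc A S)

prefix≡seg : ∀ N → prefix N ≡ seg 0 N
prefix≡seg zero    = refl
prefix≡seg (suc N) = begin
  prefix N ++ t N ∷ []       ≡⟨ cong₂ (λ u v → u ++ seg v 1) (prefix≡seg N) (sym (+-identityʳ N)) ⟩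
  seg 0 N ++ seg (N + 0) 1   ≡⟨ seg-++ 0 N 1 ⟩
  seg 0 (N + 1)              ≡⟨ cong (seg 0) (+-comm N 1) ⟩
  seg 0 (suc N)              ∎
  where open ≡-Reasoning

seg-wrap : ∀ S L → seg S (2 + L) ≡ t S ∷ (seg (suc S) L ∷ʳ t (suc L + S))
seg-wrap S L = cong (t S ∷_) (begin
  seg (suc S) (suc L)                ≡⟨ cong (seg (suc S)) (+-comm 1 L) ⟩
  seg (suc S) (L + 1)                ≡⟨ sym (seg-++ (suc S) L 1) ⟩
  seg (suc S) L ++ seg (L + suc S) 1 ≡⟨ cong (λ z → seg (suc S) L ∷ʳ t z) (+-suc L S) ⟩
  seg (suc S) L ∷ʳ t (suc L + S)     ∎)
  where open ≡-Reasoning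

reverse-wrap : ∀ (x y : Letter) m → reverse (x ∷ (m ∷ʳ y)) ≡ y ∷ (reverse m ∷ʳ x)
reverse-wrap x y m = trans (unfold-reverse x (m ∷ʳ y)) (cong (_∷ʳ x) (reverse-++ m (y ∷ [])))

palindrome-unwrap : ∀ x y m → IsPalindrome (x ∷ (m ∷ʳ y)) → x ≡ y × IsPalindrome m
palindrome-unwrap x y m pal with _ , rest ← ∷-injective (trans (sym (reverse-wrap x y m)) pal)
  with rev-m , x≡y ← ∷ʳ-injective (reverse m) m rest = x≡y , rev-m

palindrome-wrap : ∀ {x y} m → x ≡ y → IsPalindrome m → IsPalindrome (x ∷ (m ∷ʳ y))
palindrome-wrap {x} m refl pal = trans (reverse-wrap x x m) (cong (λ w → x ∷ (w ∷ʳ x)) pal)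

pal⇒palindrome : ∀ {S L} → Pal S L → IsPalindrome (seg S L)
pal⇒palindrome empty  = refl
pal⇒palindrome single = refl
pal⇒palindrome {S} (wrap {L = L} e p) =
  subst IsPalindrome (sym (seg-wrap S L)) (palindrome-wrap (seg (suc S) L) e (pal⇒palindrome p))

palindrome⇒pal : ∀ S L → IsPalindrome (seg S L) → Pal S L
palindrome⇒pal S zero          _   = empty
palindrome⇒pal S (suc zero)    _   = single
palindrome⇒pal S (suc (suc L)) pal
  with e , pal′ ← palindrome-unwrap (t S) (t (suc L + S)) (seg (suc S) L) (subst IsPalindrome (seg-wrap S L) pal) =
  wrap e (palindrome⇒pal (suc S) L pal′)

-- Cuts N k : the prefix t[0..N) is a concatenation of k nonempty palindromic factors,
-- recorded from right to left.
data Cuts : ℕ → ℕ → Set where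
  nil  : Cuts 0 0
  snoc : ∀ {S L k} → Cuts S k → Pal S (suc L) → Cuts (suc L + S) (suc k)

cuts-at : ∀ {N N′ k} → N ≡ N′ → Cuts N k → Cuts N′ k
cuts-at refl c = c

PalFactor : List Letter → Set
PalFactor p = NonEmpty p × IsPalindrome p

factors⇒cuts : ∀ ps S L {k} → All PalFactor ps → concat ps ≡ seg S L → Cuts S k → Cuts (L + S) (length ps + k)
factors⇒cuts []       S zero    _              _ c = c
factors⇒cuts (p ∷ ps) S L {k} ((ne , pal) ∷ fs) e c with seg-split p (concat ps) S L e
... | zero  , _ , _    , refl , _    = ⊥-elim (ne refl)
... | suc A , B , refl , refl , rest =
  subst₂ Cuts (trans (sym (+-assoc B (suc A) S)) (cong (_+ S) (+-comm B (suc A)))) (+-suc (length ps) k)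
    (factors⇒cuts ps (suc A + S) B fs rest (snoc c (palindrome⇒pal S (suc A) pal)))

cuts⇒factors : ∀ {N k} → Cuts N k → PalFact (seg 0 N) k
cuts⇒factors nil = [] , [] , refl , refl
cuts⇒factors (snoc {S} {L} {k} c p) with ps , fs , e , len ← cuts⇒factors c =
  ps ∷ʳ seg S (suc L) , ++⁺ fs (((λ ()) , pal⇒palindrome p) ∷ []) , concat-eq , length-eq
  where
  open ≡-Reasoning
  concat-eq : concat (ps ∷ʳ seg S (suc L)) ≡ seg 0 (suc L + S)
  concat-eq = begin
    concat (ps ∷ʳ seg S (suc L))        ≡⟨ sym (concat-++ ps (seg S (suc L) ∷ [])) ⟩
    concat ps ++ (seg S (suc L) ++ [])  ≡⟨ cong₂ _++_ e (++-identityʳ (seg S (suc L))) ⟩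
    seg 0 S ++ seg S (suc L)            ≡⟨ cong (λ z → seg 0 S ++ seg z (suc L)) (sym (+-identityʳ S)) ⟩
    seg 0 S ++ seg (S + 0) (suc L)      ≡⟨ seg-++ 0 S (suc L) ⟩
    seg 0 (S + suc L)                   ≡⟨ cong (seg 0) (+-comm S (suc L)) ⟩
    seg 0 (suc L + S)                   ∎
  length-eq : length (ps ∷ʳ seg S (suc L)) ≡ suc k
  length-eq = trans (length-++ ps) (trans (cong (_+ 1) len) (+-comm k 1))

fact⇒cuts : ∀ {N k} → PalFact (prefix N) k → Cuts N k
fact⇒cuts {N} (ps , fs , e , refl) =
  subst₂ Cuts (+-identityʳ N) (+-identityʳ (length ps)) (factors⇒cuts ps 0 N fs (trans e (prefix≡seg N)) nil)

cuts⇒fact : ∀ {N k} → Cuts N k → PalFact (prefix N) k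
cuts⇒fact {N} c = subst (λ w → PalFact w _) (sym (prefix≡seg N)) (cuts⇒factors c)

Minimal : ℕ → ℕ → Set
Minimal N k = ∀ m → Cuts N m → k ≤ m

Least : ℕ → ℕ → Set
Least N k = Cuts N k × Minimal N k

Fewer : ℕ → ℕ → ℕ → Set
Fewer N d k = ∃ λ m → Cuts N m × d + m ≤ k

ppl⇒least : ∀ {N k} → IsPPL N k → Least N k
ppl⇒least (f , min) = fact⇒cuts f , λ m c → min m (cuts⇒fact c)

ppl-from-bounds : ∀ {N k} → Fewer N 0 k → Minimal N k → IsPPL N k
ppl-from-bounds {N} (m , c , m≤k) min =
  subst (PalFact (prefix N)) (≤-antisym m≤k (min m c)) (cuts⇒fact c) , λ m f → min m (fact⇒cuts f)

cuts-×4 : ∀ {N k} → Cuts N k → Cuts (N * 4) k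
cuts-×4 nil                = nil
cuts-×4 (snoc {S} {L} c p) = cuts-at (regroup (suc L) 0 S) (snoc (cuts-×4 c) (pal-×4 p))

cuts-4n+2 : ∀ {n k} → Cuts n k → Cuts (2 + n * 4) (2 + k)
cuts-4n+2 c = snoc (snoc (cuts-×4 c) single) single

-- From a factorization of t[0..n+1): keep the image of its last factor without its first two
-- and last two letters, and write the first two as single letters.
cuts-4n+2′ : ∀ {n k} → Cuts (suc n) k → Fewer (2 + n * 4) 0 (2 + k)
cuts-4n+2′ (snoc {L = zero} c _) = _ , cuts-4n+2 c , n≤1+n _
cuts-4n+2′ (snoc {S} {suc L} c p) =
  _ , cuts-at (cong (4 +_) (regroup L 2 S))
        (snoc (snoc (snoc (cuts-×4 c) single) single) (peel (peel (pal-×4 p)))) , ≤-refl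

-- Likewise, keeping the image of the last factor without its first and last letters.
cuts-4n+3 : ∀ {n k} → Cuts (suc n) k → Cuts (3 + n * 4) (suc k)
cuts-4n+3 (snoc {S} {L} c p) =
  cuts-at (cong (2 +_) (regroup L 1 S)) (snoc (snoc (cuts-×4 c) single) (peel (pal-×4 p)))

data R4 : Set where
  r₀ r₁ r₂ r₃ : R4

⟦_⟧ : R4 → ℕ
⟦ r₀ ⟧ = 0
⟦ r₁ ⟧ = 1
⟦ r₂ ⟧ = 2
⟦ r₃ ⟧ = 3

⟦_⟧<4 : ∀ r → ⟦ r ⟧ < 4
⟦ r₀ ⟧<4 = s≤s z≤n
⟦ r₁ ⟧<4 = s≤s (s≤s z≤n)
⟦ r₂ ⟧<4 = s≤s (s≤s (s≤s z≤n))
⟦ r₃ ⟧<4 = s≤s (s≤s (s≤s (s≤s z≤n)))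

toR4 : ℕ → R4
toR4 0 = r₀
toR4 1 = r₁
toR4 2 = r₂
toR4 _ = r₃

toR4-⟦⟧ : ∀ r → toR4 ⟦ r ⟧ ≡ r
toR4-⟦⟧ r₀ = refl
toR4-⟦⟧ r₁ = refl
toR4-⟦⟧ r₂ = refl
toR4-⟦⟧ r₃ = refl

residue-unique : ∀ {n n′ r r′} → ⟦ r ⟧ + n * 4 ≡ ⟦ r′ ⟧ + n′ * 4 → r ≡ r′ × n ≡ n′
residue-unique {n} {n′} {r} {r′} e =
  trans (sym (toR4-⟦⟧ r)) (trans (cong toR4 rem≡) (toR4-⟦⟧ r′)) ,
  *-cancelʳ-≡ n n′ 4 (+-cancelˡ-≡ ⟦ r ⟧ _ _ (trans e (cong (_+ n′ * 4) (sym rem≡))))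
  where
  open ≡-Reasoning
  rem≡ : ⟦ r ⟧ ≡ ⟦ r′ ⟧
  rem≡ = begin
    ⟦ r ⟧                  ≡⟨ sym (m<n⇒m%n≡m ⟦ r ⟧<4) ⟩
    ⟦ r ⟧ % 4              ≡⟨ sym ([m+kn]%n≡m%n ⟦ r ⟧ n 4) ⟩
    (⟦ r ⟧ + n * 4) % 4    ≡⟨ cong (_% 4) e ⟩
    (⟦ r′ ⟧ + n′ * 4) % 4  ≡⟨ [m+kn]%n≡m%n ⟦ r′ ⟧ n′ 4 ⟩
    ⟦ r′ ⟧ % 4             ≡⟨ m<n⇒m%n≡m ⟦ r′ ⟧<4 ⟩
    ⟦ r′ ⟧                 ∎

-- Goal n r k : what a factorization of t[0..4n+r) into k factors yields at the coarser scale,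
-- i.e. the lower-bound half of the theorem for residue r.
Goal : ℕ → R4 → ℕ → Set
Goal n r₀ k = Fewer n 0 k
Goal n r₁ k = Fewer n 1 k
Goal n r₂ k = Fewer n 2 k ⊎ Fewer (suc n) 2 k
Goal n r₃ k = Fewer (suc n) 1 k

LowerBound : ℕ → ℕ → Set
LowerBound N k = ∀ n r → N ≡ ⟦ r ⟧ + n * 4 → Goal n r k

lower-bound-at : ∀ {N k} n r → N ≡ ⟦ r ⟧ + n * 4 → Goal n r k → LowerBound N k
lower-bound-at n r e g n′ r′ e′ with refl , refl ← residue-unique {n} {n′} {r} {r′} (trans (sym e) e′) = g

fewer-at : ∀ {N N′ d k} → N ≡ N′ → Fewer N d k → Fewer N′ d k
fewer-at refl f = f

fewer-suc : ∀ {N d k} → Fewer N d k → Fewer N (suc d) (suc k)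
fewer-suc (m , c , le) = m , c , s≤s le

fewer-weaken : ∀ {N d d′ k} → d′ ≤ d → Fewer N d k → Fewer N d′ k
fewer-weaken d′≤d (m , c , le) = m , c , ≤-trans (+-monoˡ-≤ m d′≤d) le

fewer-append : ∀ {S L d k} → Fewer S d k → Pal S L → Fewer (L + S) d (suc k)
fewer-append {L = zero}          (m , c , le) _ = m , c , m≤n⇒m≤1+n le
fewer-append {L = suc _} {d} {k} (m , c , le) p =
  suc m , snoc c p , subst (_≤ suc k) (sym (+-suc d m)) (s≤s le)

fewer-bound : ∀ {N k d m} → Minimal N k → Fewer N d m → d + k ≤ m
fewer-bound {d = d} min (m′ , c , le) = ≤-trans (+-monoʳ-≤ d (min m′ c)) le

fewer-⊓ : ∀ {N d k k′} → Fewer N d k → Fewer N d k′ → Fewer N d (k ⊓ k′)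
fewer-⊓ {N} {d} {k} {k′} f f′ with ⊓-sel k k′
... | inj₁ e = subst (Fewer N d) (sym e) f
... | inj₂ e = subst (Fewer N d) (sym e) f′

-- The two transitions that need a case split: a letter appended at position 4s+2 (which
-- also covers length-3 palindromes there), and an even palindrome starting at 4s+2.
after-letter₂ : ∀ {s k} → Goal s r₂ k → Goal s r₃ (suc k)
after-letter₂ (inj₁ f) = fewer-weaken (n≤1+n 1) (fewer-append f single)
after-letter₂ (inj₂ f) = fewer-weaken (s≤s z≤n) (fewer-suc f)

after-even₂ : ∀ {s N k} → Goal s r₂ k → Pal s (2 + N) → Goal (suc N + s) r₂ (suc k)
after-even₂ (inj₁ f) p = inj₂ (fewer-append f p)
after-even₂ {s} {N} (inj₂ f) p = inj₁ (fewer-at (+-suc N s) (fewer-append f (peel p)))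

extend-bound : ∀ {S L k} → LowerBound S k → Pal S (suc L) → LowerBound (suc L + S) (suc k)
extend-bound {S} lb p with shape p
... | letter refl with residue4 S
...   | at₀ s = lower-bound-at s r₁ refl (fewer-suc (lb s r₀ refl))
...   | at₁ s = lower-bound-at s r₂ refl (inj₁ (fewer-suc (lb s r₁ refl)))
...   | at₂ s = lower-bound-at s r₃ refl (after-letter₂ (lb s r₂ refl))
...   | at₃ s = lower-bound-at (suc s) r₀ refl (fewer-weaken z≤n (fewer-suc (lb s r₃ refl)))
extend-bound lb p | odd₂ s refl refl =
  lower-bound-at (suc s) r₁ refl (after-letter₂ (lb s r₂ refl))
extend-bound lb p | odd₃ s refl refl =
  lower-bound-at (suc s) r₂ refl (inj₁ (fewer-suc (lb s r₃ refl)))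
extend-bound lb p | even₀ s N refl refl =
  lower-bound-at (suc N + s) r₀ (regroup (suc N) 0 s) (fewer-append (lb s r₀ refl) (pal-÷4 s (suc N) p))
extend-bound lb p | even₁ s N refl refl =
  lower-bound-at (N + s) r₃ (cong (2 +_) (regroup N 1 s)) (fewer-append (lb s r₁ refl) (pal-÷4-from₁ s N p))
extend-bound lb p | even₂ s N refl refl =
  lower-bound-at (suc N + s) r₂ (cong (4 +_) (regroup N 2 s)) (after-even₂ (lb s r₂ refl) (pal-÷4-from₂ s N p))
extend-bound lb p | even₃ s N refl refl =
  lower-bound-at (suc N + s) r₁ (cong (2 +_) (regroup N 3 s))
    (fewer-at (+-suc N s) (fewer-append (lb s r₃ refl) (pal-÷4-from₃ s N p)))

lower-bound : ∀ {N k} → Cuts N k → LowerBound N k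
lower-bound nil        = lower-bound-at 0 r₀ refl (0 , nil , z≤n)
lower-bound (snoc c p) = extend-bound (lower-bound c) p

ppl-4n : ∀ {n p} → Least n p → IsPPL (n * 4) p
ppl-4n {n} {p} (c , min) =
  ppl-from-bounds (p , cuts-×4 c , ≤-refl) λ m c′ → fewer-bound min (lower-bound c′ n r₀ refl)

ppl-4n+1 : ∀ {n p} → Least n p → IsPPL (1 + n * 4) (1 + p)
ppl-4n+1 {n} {p} (c , min) =
  ppl-from-bounds (suc p , snoc (cuts-×4 c) single , ≤-refl) λ m c′ → fewer-bound min (lower-bound c′ n r₁ refl)

ppl-4n+2 : ∀ {n p q} → Least n p → Least (suc n) q → IsPPL (2 + n * 4) (2 + p ⊓ q)
ppl-4n+2 {n} {p} {q} (c , min) (c′ , min′) =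
  ppl-from-bounds (fewer-⊓ (2 + p , cuts-4n+2 c , ≤-refl) (cuts-4n+2′ c′)) lower
  where
  lower : Minimal (2 + n * 4) (2 + p ⊓ q)
  lower m c″ with lower-bound c″ n r₂ refl
  ... | inj₁ f = ≤-trans (+-monoʳ-≤ 2 (m⊓n≤m p q)) (fewer-bound min f)
  ... | inj₂ f = ≤-trans (+-monoʳ-≤ 2 (m⊓n≤n p q)) (fewer-bound min′ f)

ppl-4n+3 : ∀ {n q} → Least (suc n) q → IsPPL (3 + n * 4) (1 + q)
ppl-4n+3 {n} {q} (c , min) =
  ppl-from-bounds (suc q , cuts-4n+3 c , ≤-refl) λ m c′ → fewer-bound min (lower-bound c′ n r₃ refl)

theorem4 : (n p q : ℕ) → IsPPL n p → IsPPL (n + 1) q →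
    IsPPL (4 * n) p × IsPPL (4 * n + 1) (p + 1) ×
    IsPPL (4 * n + 2) ((p ⊓ q) + 2) × IsPPL (4 * n + 3) (q + 1)
theorem4 n p q ppl-n ppl-n+1 =
  subst (λ N → IsPPL N p) (*-comm n 4) (ppl-4n least-n) ,
  subst₂ IsPPL (position 1) (+-comm 1 p) (ppl-4n+1 least-n) ,
  subst₂ IsPPL (position 2) (+-comm 2 (p ⊓ q)) (ppl-4n+2 least-n least-n+1) ,
  subst₂ IsPPL (position 3) (+-comm 1 q) (ppl-4n+3 least-n+1)
  where
  least-n : Least n p
  least-n = ppl⇒least ppl-n
  least-n+1 : Least (suc n) q
  least-n+1 = ppl⇒least (subst (λ N → IsPPL N q) (+-comm n 1) ppl-n+1)
  position : ∀ r → r + n * 4 ≡ 4 * n + r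
  position r = trans (+-comm r (n * 4)) (cong (_+ r) (*-comm n 4))
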